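{- A finite simple graph $H$ is realizable if and only if it is realizable by a cubic directed multigraph, i.e., there exists a directed multigraph $G$ in which every vertex has total degree (in-degree plus out-degree) equal to $3$ and whose hike dependency graph $\phi(G)$ is isomorphic to $H$.
   Context: A directed multigraph has a finite vertex set and a finite multiset of arcs (loops and multiple arcs allowed). A simple cycle is a closed sequence of arcs $(i_0,i_1)_{k_1}\cdots(i_{\ell-1},i_0)_{k_\ell}$, $\ell\ge1$, with all $i_t$ distinct, considered up to cyclic rotation (orientation and the specific arcs used matter; a self-loop is a simple cycle of length one). The hike dependency graph $\phi(G)$ is the simple graph whose vertices are the simple cycles of $G$, two distinct simple cycles being adjacent iff they share a vertex of $G$. $H$ is realizable if $H\cong\phi(G)$ for some directed multigraph $G$. -}

module Defs where

open import Data.Nat using (ℕ; suc; _+_; _%_)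
open import Data.Nat.DivMod using (m%n<n)
open import Data.Fin using (Fin; toℕ; fromℕ<; _≟_)
open import Data.List using (length; filter; allFin)
open import Data.Bool using (Bool; true; false)
open import Data.Product using (Σ; ∃; ∃-syntax; _×_)
open import Relation.Nullary using (¬_)
open import Relation.Binary.PropositionalEquality using (_≡_)
open import Function.Bundles using (_⇔_)

-- A finite directed multigraph: vertices Fin n, arcs Fin m (so parallel arcs
-- are distinguished by their index), each arc has a source and a target.
-- Loops (src a ≡ tgt a) are allowed.
record Digraph : Set where
  field
    n   : ℕ
    m   : ℕ
    src : Fin m → Fin n
    tgt : Fin m → Fin n

module _ (G : Digraph) where
  open Digraph G

  indeg : Fin n → ℕ
  indeg v = length (filter (λ a → tgt a ≟ v) (allFin m))

  outdeg : Fin n → ℕ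
  outdeg v = length (filter (λ a → src a ≟ v) (allFin m))

  -- every vertex has total degree (in + out) 3 (a loop contributes 1 to each)
  Cubic : Set
  Cubic = ∀ v → indeg v + outdeg v ≡ 3

  cyc : (l : ℕ) → ℕ → Fin (suc l)
  cyc l i = fromℕ< (m%n<n i (suc l))

  record SimpleCycle : Set where
    field
      len      : ℕ
      arc      : Fin (suc len) → Fin m
      closed   : ∀ i → tgt (arc (cyc len i)) ≡ src (arc (cyc len (suc i)))
      distinct : ∀ s t → src (arc s) ≡ src (arc t) → s ≡ t

  open SimpleCycle

  arcℕ : (C : SimpleCycle) → ℕ → Fin m
  arcℕ C i = arc C (cyc (len C) i)

  -- equality of simple cycles: up to cyclic rotation
  _∼_ : SimpleCycle → SimpleCycle → Set
  C ∼ D = (len C ≡ len D) × ∃[ r ] (∀ i → arcℕ C (i + r) ≡ arcℕ D i)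

  Share : SimpleCycle → SimpleCycle → Set
  Share C D = ∃[ s ] ∃[ t ] (src (arc C s) ≡ src (arc D t))

  PhiAdj : SimpleCycle → SimpleCycle → Set
  PhiAdj C D = ¬ (C ∼ D) × Share C D

record SimpleGraph : Set where
  field
    k      : ℕ
    adj    : Fin k → Fin k → Bool
    sym    : ∀ i j → adj i j ≡ adj j i
    irrefl : ∀ i → adj i i ≡ false

-- H ≅ φ(G): a bijection f from the vertices of H onto the simple cycles of G
-- modulo rotation, preserving and reflecting adjacency.
record PhiIso (G : Digraph) (H : SimpleGraph) : Set where
  open SimpleGraph H
  field
    f        : Fin k → SimpleCycle G
    f-inj    : ∀ i j → _∼_ G (f i) (f j) → i ≡ j
    f-surj   : ∀ C → ∃[ i ] _∼_ G (f i) C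
    f-adj    : ∀ i j → (adj i j ≡ true) ⇔ PhiAdj G (f i) (f j)

Realizable : SimpleGraph → Set
Realizable H = ∃[ G ] PhiIso G H

CubicRealizable : SimpleGraph → Set
CubicRealizable H = ∃[ G ] (Cubic G × PhiIso G H)

-- A vertex of degree ≠ 3 can be repaired without changing φ(G) up to isomorphism.
-- If v has degree ≤ 2, add three arcs from v to a new sink: a sink lies on no cycle, so
-- the simple cycles and the vertices they meet are unchanged.  If v has degree ≥ 4 and
-- two in-arcs a and b, redirect a and b to a new vertex z and add the arc z → v.  As a
-- and b both end at v, a simple cycle uses at most one of them; inserting z after that
-- arc is a bijection between the simple cycles of the two graphs, and a lifted cycle
-- meets z only when it also meets v, so sharing a vertex is preserved and reflected.
-- Otherwise v has at least two out-arcs, and the same repair is made in the reversed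
-- graph, whose simple cycles are those of G read backwards.  Each repair lowers
-- Σ_v defect (deg v), so repeating it ends in a cubic graph with the same φ.

module Submission where

open import Defs
open import Data.Bool using (Bool; true; false; if_then_else_; _∨_)
import Data.Bool.Properties as Boolₚ
open import Data.Empty using (⊥-elim)
open import Data.Fin as Fin using (Fin; toℕ; _≟_)
import Data.Fin.Properties as Finₚ
open import Data.List using (length; filter; tabulate)
open import Data.Nat as ℕ using (ℕ; zero; suc; _+_; _*_; _%_; _<_; _≤_; z≤n; s≤s; s≤s⁻¹; NonZero)
open import Data.Nat.DivMod
open import Data.Nat.Induction using (<-wellFounded)
open import Data.Nat.Properties hiding (_≟_)
open import Algebra.Properties.CommutativeMonoid.Sum +-0-commutativeMonoid using (sum; sum-cong-≗; ∑-distrib-+)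
open import Data.Nat.Tactic.RingSolver using (solve-∀)
open import Data.Product using (∃; ∃-syntax; ∃₂; _×_; _,_; proj₁; proj₂)
open import Data.Sum using (_⊎_; inj₁; inj₂)
open import Function.Base using (_∘_)
open import Function.Bundles using (_⇔_; mk⇔; Equivalence)
open import Induction.WellFounded using (WellFounded; Acc; acc)
open import Relation.Binary using (tri<; tri≈; tri>)
import Relation.Binary.Construct.On as On
open import Relation.Binary.PropositionalEquality
open import Relation.Nullary using (¬_; Dec; yes; no; does; ¬?)
open import Relation.Nullary.Decidable using (decidable-stable)
open import Relation.Unary using (Pred; Decidable)

module _ (n : ℕ) .{{_ : NonZero n}} where
  open ≡-Reasoning

  %-cong-+ʳ : ∀ a b c → a % n ≡ b % n → (a + c) % n ≡ (b + c) % n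
  %-cong-+ʳ a b c a≡b = begin
    (a + c) % n          ≡⟨ %-distribˡ-+ a c n ⟩
    (a % n + c % n) % n  ≡⟨ cong (λ x → (x + c % n) % n) a≡b ⟩
    (b % n + c % n) % n  ≡⟨ %-distribˡ-+ b c n ⟨
    (b + c) % n          ∎

  %-cong-+ˡ : ∀ c a b → a % n ≡ b % n → (c + a) % n ≡ (c + b) % n
  %-cong-+ˡ c a b a≡b = begin
    (c + a) % n  ≡⟨ cong (_% n) (+-comm c a) ⟩
    (a + c) % n  ≡⟨ %-cong-+ʳ a b c a≡b ⟩
    (b + c) % n  ≡⟨ cong (_% n) (+-comm b c) ⟩
    (c + b) % n  ∎

  %-cong-*ˡ : ∀ c a b → a % n ≡ b % n → (c * a) % n ≡ (c * b) % n
  %-cong-*ˡ c a b a≡b = begin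
    (c * a) % n            ≡⟨ %-distribˡ-* c a n ⟩
    (c % n * (a % n)) % n  ≡⟨ cong (λ x → (c % n * x) % n) a≡b ⟩
    (c % n * (b % n)) % n  ≡⟨ %-distribˡ-* c b n ⟨
    (c * b) % n            ∎

  [m+kn]≡[o+jn]⇒m%n≡o%n : ∀ x k y j → x + k * n ≡ y + j * n → x % n ≡ y % n
  [m+kn]≡[o+jn]⇒m%n≡o%n x k y j eq = begin
    x % n            ≡⟨ [m+kn]%n≡m%n x k n ⟨
    (x + k * n) % n  ≡⟨ cong (_% n) eq ⟩
    (y + j * n) % n  ≡⟨ [m+kn]%n≡m%n y j n ⟩
    y % n            ∎

  %-cancel-+ʳ : ∀ a b c → (a + c) % n ≡ (b + c) % n → a % n ≡ b % n
  %-cancel-+ʳ a b c eq = begin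
    a % n                       ≡⟨ [m+kn]%n≡m%n a c n ⟨
    (a + c * n) % n             ≡⟨ cong (_% n) (complete a) ⟩
    (a + c + ℕ.pred n * c) % n  ≡⟨ %-cong-+ʳ (a + c) (b + c) (ℕ.pred n * c) eq ⟩
    (b + c + ℕ.pred n * c) % n  ≡⟨ cong (_% n) (complete b) ⟨
    (b + c * n) % n             ≡⟨ [m+kn]%n≡m%n b c n ⟩
    b % n                       ∎
    where
    complete : ∀ x → x + c * n ≡ x + c + ℕ.pred n * c
    complete x = subst (λ k → x + c * k ≡ x + c + ℕ.pred n * c) (suc-pred n) (peel x c (ℕ.pred n))
      where
      peel : ∀ x c p → x + c * suc p ≡ x + c + p * c
      peel = solve-∀

  %-cancel-+ˡ : ∀ c a b → (c + a) % n ≡ (c + b) % n → a % n ≡ b % n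
  %-cancel-+ˡ c a b eq = %-cancel-+ʳ a b c (subst₂ (λ x y → x % n ≡ y % n) (+-comm c a) (+-comm c b) eq)

  %-injective-< : ∀ {a b} → a < n → b < n → a % n ≡ b % n → a ≡ b
  %-injective-< a<n b<n eq = trans (sym (m<n⇒m%n≡m a<n)) (trans eq (m<n⇒m%n≡m b<n))

  suc-%-% : ∀ i → suc i % n ≡ suc (i % n) % n
  suc-%-% i = %-cong-+ˡ 1 i (i % n) (sym (m%n%n≡m%n i n))

%-cancel-*ˡ-pred : ∀ l a b → (l * a) % suc l ≡ (l * b) % suc l → a % suc l ≡ b % suc l
%-cancel-*ˡ-pred l a b eq = begin
  a % L                  ≡⟨ [m+kn]%n≡m%n a b L ⟨
  (a + b * L) % L        ≡⟨ cong (_% L) (complete l b a) ⟨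
  (l * b + (b + a)) % L  ≡⟨ cong (λ x → (l * b + x) % L) (+-comm b a) ⟩
  (l * b + (a + b)) % L  ≡⟨ %-cong-+ʳ L (l * b) (l * a) (a + b) (sym eq) ⟩
  (l * a + (a + b)) % L  ≡⟨ cong (_% L) (complete l a b) ⟩
  (b + a * L) % L        ≡⟨ [m+kn]%n≡m%n b a L ⟩
  b % L                  ∎
  where
  open ≡-Reasoning
  L : ℕ
  L = suc l
  complete : ∀ l a b → l * a + (a + b) ≡ b + a * suc l
  complete = solve-∀

%-*ˡ-pred-involutive : ∀ l i → (l * (l * i)) % suc l ≡ i % suc l
%-*ˡ-pred-involutive l i = [m+kn]≡[o+jn]⇒m%n≡o%n (suc l) (l * (l * i)) i i (l * i) (complete l i)
  where
  complete : ∀ l i → l * (l * i) + i * suc l ≡ i + l * i * suc l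
  complete = solve-∀

module Cycles (G : Digraph) where
  open Digraph G
  open SimpleCycle public
  open ≡-Reasoning

  Cycle : Set
  Cycle = SimpleCycle G

  infix 4 _≈_
  _≈_ : Cycle → Cycle → Set
  _≈_ = _∼_ G

  arcAt : Cycle → ℕ → Fin m
  arcAt = arcℕ G

  cyc-cong : ∀ l i j → i % suc l ≡ j % suc l → cyc G l i ≡ cyc G l j
  cyc-cong l i j eq = Finₚ.fromℕ<-cong (i % suc l) (j % suc l) eq _ _

  toℕ-cyc : ∀ l i → toℕ (cyc G l i) ≡ i % suc l
  toℕ-cyc l i = Finₚ.toℕ-fromℕ< _

  cyc-toℕ : ∀ l (s : Fin (suc l)) → cyc G l (toℕ s) ≡ s
  cyc-toℕ l s =
    trans (Finₚ.fromℕ<-cong (toℕ s % suc l) (toℕ s) (m<n⇒m%n≡m (Finₚ.toℕ<n s)) _ (Finₚ.toℕ<n s))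
                     (Finₚ.fromℕ<-toℕ s _)

  module _ (C : Cycle) where
    private
      L : ℕ
      L = suc (len C)

    arcAt-cong : ∀ i j → i % L ≡ j % L → arcAt C i ≡ arcAt C j
    arcAt-cong i j eq = cong (arc C) (cyc-cong (len C) i j eq)

    arcAt-+*-cong : ∀ x k y j → x + k * L ≡ y + j * L → arcAt C x ≡ arcAt C y
    arcAt-+*-cong x k y j eq = arcAt-cong x y ([m+kn]≡[o+jn]⇒m%n≡o%n L x k y j eq)

    arcAt-% : ∀ i → arcAt C (i % L) ≡ arcAt C i
    arcAt-% i = arcAt-cong (i % L) i (m%n%n≡m%n i L)

    arcAt-periodic : ∀ i → arcAt C (i + L) ≡ arcAt C i
    arcAt-periodic i = arcAt-cong (i + L) i ([m+n]%n≡m%n i L)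

    arcAt-toℕ : ∀ s → arcAt C (toℕ s) ≡ arc C s
    arcAt-toℕ s = cong (arc C) (cyc-toℕ (len C) s)

    src-arcAt-injective : ∀ i j → src (arcAt C i) ≡ src (arcAt C j) → i % L ≡ j % L
    src-arcAt-injective i j eq = begin
      i % L                  ≡⟨ toℕ-cyc (len C) i ⟨
      toℕ (cyc G (len C) i)  ≡⟨ cong toℕ (distinct C _ _ eq) ⟩
      toℕ (cyc G (len C) j)  ≡⟨ toℕ-cyc (len C) j ⟩
      j % L                  ∎

    src-arcAt-injective-< : ∀ {i j} → i < L → j < L → src (arcAt C i) ≡ src (arcAt C j) → i ≡ j
    src-arcAt-injective-< {i} {j} i<L j<L = %-injective-< L i<L j<L ∘ src-arcAt-injective i j

    tgt-arcAt-injective : ∀ i j → tgt (arcAt C i) ≡ tgt (arcAt C j) → i % L ≡ j % L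
    tgt-arcAt-injective i j eq =
      %-cancel-+ˡ L 1 i j (src-arcAt-injective (suc i) (suc j) (trans (sym (closed C i)) (trans eq (closed C j))))

  record PeriodicCycle : Set where
    field
      lastIndex : ℕ
      arcs      : ℕ → Fin m
      periodic  : ∀ i → arcs (i % suc lastIndex) ≡ arcs i
      linked    : ∀ i → tgt (arcs i) ≡ src (arcs (suc i))
      injective : ∀ {i j} → i < suc lastIndex → j < suc lastIndex → src (arcs i) ≡ src (arcs j) → i ≡ j

  toCycle : PeriodicCycle → Cycle
  toCycle P = record
    { len      = lastIndex
    ; arc      = arcs ∘ toℕ
    ; closed   = λ i → begin
        tgt (arcs (toℕ (cyc G lastIndex i)))        ≡⟨ cong (tgt ∘ arcs) (toℕ-cyc lastIndex i) ⟩
        tgt (arcs (i % suc lastIndex))              ≡⟨ cong tgt (periodic i) ⟩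
        tgt (arcs i)                                ≡⟨ linked i ⟩
        src (arcs (suc i))                          ≡⟨ cong src (periodic (suc i)) ⟨
        src (arcs (suc i % suc lastIndex))          ≡⟨ cong (src ∘ arcs) (toℕ-cyc lastIndex (suc i)) ⟨
        src (arcs (toℕ (cyc G lastIndex (suc i))))  ∎
    ; distinct = λ s t eq → Finₚ.toℕ-injective (injective (Finₚ.toℕ<n s) (Finₚ.toℕ<n t) eq)
    }
    where open PeriodicCycle P

  arcAt-toCycle : ∀ P i → arcAt (toCycle P) i ≡ PeriodicCycle.arcs P i
  arcAt-toCycle P i = trans (cong arcs (toℕ-cyc lastIndex i)) (periodic i)
    where open PeriodicCycle P

  ≈-refl : ∀ C → C ≈ C
  ≈-refl C = refl , 0 , λ i → cong (arcAt C) (+-identityʳ i)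

  ≈-trans : ∀ C D E → C ≈ D → D ≈ E → C ≈ E
  ≈-trans C D E (l₁ , r , C≗D) (l₂ , s , D≗E) =
    trans l₁ l₂ , s + r , λ i → trans (cong (arcAt C) (sym (+-assoc i s r))) (trans (C≗D (i + s)) (D≗E i))

  ≈-sym : ∀ C D → C ≈ D → D ≈ C
  ≈-sym C D (l , r , C≗D) = sym l , len C * r , λ i → begin
    arcAt D (i + len C * r)      ≡⟨ C≗D (i + len C * r) ⟨
    arcAt C (i + len C * r + r)  ≡⟨ arcAt-+*-cong C _ 0 i r (wrap i (len C) r) ⟩
    arcAt C i                    ∎
    where
    wrap : ∀ i l r → i + l * r + r + 0 * suc l ≡ i + r * suc l
    wrap = solve-∀

  ≈-pointwise : ∀ C D → len C ≡ len D → (∀ i → arcAt C i ≡ arcAt D i) → C ≈ D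
  ≈-pointwise C D l C≗D = l , 0 , λ i → trans (cong (arcAt C) (+-identityʳ i)) (C≗D i)

  ≈-anchored : ∀ C D x → C ≈ D → src (arcAt C x) ≡ src (arcAt D x) → ∀ i → arcAt C i ≡ arcAt D i
  ≈-anchored C D x (_ , r , C≗D) anchor i = begin
    arcAt C i        ≡⟨ arcAt-cong C (i + r) i (trans (%-cong-+ˡ L i r 0 r≡0) (cong (_% L) (+-identityʳ i))) ⟨
    arcAt C (i + r)  ≡⟨ C≗D i ⟩
    arcAt D i        ∎
    where
    L : ℕ
    L = suc (len C)
    r≡0 : r % L ≡ 0 % L
    r≡0 = %-cancel-+ˡ L x r 0 (trans (src-arcAt-injective C (x + r) x (trans (cong src (C≗D x)) (sym anchor)))
                                (cong (_% L) (sym (+-identityʳ x))))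

  rotation : Cycle → ℕ → PeriodicCycle
  rotation C r = record
    { lastIndex = len C
    ; arcs      = λ i → arcAt C (i + r)
    ; periodic  = λ i → arcAt-cong C (i % L + r) (i + r) (%-cong-+ʳ L (i % L) i r (m%n%n≡m%n i L))
    ; linked    = λ i → closed C (i + r)
    ; injective = λ {i} {j} i<L j<L eq →
        %-injective-< L i<L j<L (%-cancel-+ʳ L i j r (src-arcAt-injective C (i + r) (j + r) eq))
    }
    where
    L : ℕ
    L = suc (len C)

  rotate : Cycle → ℕ → Cycle
  rotate C r = toCycle (rotation C r)

  arcAt-rotate : ∀ C r i → arcAt (rotate C r) i ≡ arcAt C (i + r)
  arcAt-rotate C r = arcAt-toCycle (rotation C r)

  ≈-rotate : ∀ C r → C ≈ rotate C r
  ≈-rotate C r = refl , r , λ i → sym (arcAt-rotate C r i)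

  arcAt-rotate-last : ∀ C p → arcAt (rotate C (suc (toℕ p))) (len C) ≡ arc C p
  arcAt-rotate-last C p = begin
    arcAt (rotate C (suc (toℕ p))) (len C)  ≡⟨ arcAt-rotate C (suc (toℕ p)) (len C) ⟩
    arcAt C (len C + suc (toℕ p))           ≡⟨ arcAt-+*-cong C _ 0 (toℕ p) 1 (wrap (len C) (toℕ p)) ⟩
    arcAt C (toℕ p)                         ≡⟨ arcAt-toℕ C p ⟩
    arc C p                                 ∎
    where
    wrap : ∀ l p → l + suc p + 0 * suc l ≡ p + 1 * suc l
    wrap = solve-∀

  share : ∀ C D i j → src (arcAt C i) ≡ src (arcAt D j) → Share G C D
  share C D i j eq = cyc G (len C) i , cyc G (len D) j , eq

  share⁻¹ : ∀ C D → Share G C D → ∃₂ λ i j → src (arcAt C i) ≡ src (arcAt D j)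
  share⁻¹ C D (s , t , eq) =
    toℕ s , toℕ t , trans (cong src (arcAt-toℕ C s)) (trans eq (cong src (sym (arcAt-toℕ D t))))

  Share-resp-≈ : ∀ C C′ D D′ → C ≈ C′ → D ≈ D′ → Share G C D → Share G C′ D′
  Share-resp-≈ C C′ D D′ C≈C′ D≈D′ sh with share⁻¹ C D sh | ≈-sym C C′ C≈C′ | ≈-sym D D′ D≈D′
  ... | i , j , eq | _ , r , C′≗C | _ , s , D′≗D =
    share C′ D′ (i + r) (j + s) (trans (cong src (C′≗C i)) (trans eq (cong src (sym (D′≗D j)))))

record CycleCorrespondence (G G′ : Digraph) : Set where
  private
    module C = Cycles G
    module C′ = Cycles G′
  field
    lift          : C.Cycle → C′.Cycle
    lift-≈        : ∀ C D → C C.≈ D → lift C C′.≈ lift D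
    lift-≈⁻¹      : ∀ C D → lift C C′.≈ lift D → C C.≈ D
    lift-onto     : ∀ D → ∃[ C ] lift C C′.≈ D
    lift-Share    : ∀ C D → Share G C D → Share G′ (lift C) (lift D)
    lift-Share⁻¹  : ∀ C D → Share G′ (lift C) (lift D) → Share G C D

transport : ∀ {G G′ H} → CycleCorrespondence G G′ → PhiIso G H → PhiIso G′ H
transport {G′ = G′} K P = record
  { f      = lift ∘ f
  ; f-inj  = λ i j → f-inj i j ∘ lift-≈⁻¹ (f i) (f j)
  ; f-surj = λ D → let C , C≈D = lift-onto D ; i , fi≈C = f-surj C in
                   i , Cycles.≈-trans G′ (lift (f i)) (lift C) D (lift-≈ (f i) C fi≈C) C≈D
  ; f-adj  = λ i j → mk⇔
      (λ adj → let ≉ , sh = Equivalence.to (f-adj i j) adj in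
               (≉ ∘ lift-≈⁻¹ (f i) (f j)) , lift-Share (f i) (f j) sh)
      (λ (≉ , sh) → Equivalence.from (f-adj i j) ((≉ ∘ lift-≈ (f i) (f j)) , lift-Share⁻¹ (f i) (f j) sh))
  }
  where
  open CycleCorrespondence K
  open PhiIso P

record Embedding (G G′ : Digraph) : Set where
  private
    module G = Digraph G
    module G′ = Digraph G′
  field
    arcMap            : Fin G.m → Fin G′.m
    vertexMap         : Fin G.n → Fin G′.n
    arcMap-injective    : ∀ {a b} → arcMap a ≡ arcMap b → a ≡ b
    vertexMap-injective : ∀ {v w} → vertexMap v ≡ vertexMap w → v ≡ w
    src-commutes      : ∀ a → G′.src (arcMap a) ≡ vertexMap (G.src a)
    tgt-commutes      : ∀ a → G′.tgt (arcMap a) ≡ vertexMap (G.tgt a)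

module _ {G G′ : Digraph} (E : Embedding G G′) where
  open Embedding E
  private
    module G = Digraph G
    module G′ = Digraph G′
    module C = Cycles G
    module C′ = Cycles G′

  embedding-correspondence : (∀ D i → ∃ λ a → C′.arcAt D i ≡ arcMap a) → CycleCorrespondence G G′
  embedding-correspondence covered = record
    { lift         = lift
    ; lift-≈       = λ C D (l , r , C≗D) → l , r , λ i →
        trans (arcAt-lift C (i + r)) (trans (cong arcMap (C≗D i)) (sym (arcAt-lift D i)))
    ; lift-≈⁻¹     = λ C D (l , r , C≗D) → l , r , λ i →
        arcMap-injective (trans (sym (arcAt-lift C (i + r))) (trans (C≗D i) (arcAt-lift D i)))
    ; lift-onto    = λ D → C.toCycle (restriction D) ,
        C′.≈-pointwise (lift (C.toCycle (restriction D))) D refl (λ i →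
          trans (arcAt-lift (C.toCycle (restriction D)) i)
                (trans (cong arcMap (C.arcAt-toCycle (restriction D) i)) (sym (preimage D i))))
    ; lift-Share   = λ C D sh → let i , j , eq = C.share⁻¹ C D sh in
        C′.share (lift C) (lift D) i j (src-lift C D i j (cong vertexMap eq))
    ; lift-Share⁻¹ = λ C D sh → let i , j , eq = C′.share⁻¹ (lift C) (lift D) sh in
        C.share C D i j (vertexMap-injective (src-lift⁻¹ C D i j eq))
    }
    where
    image : C.Cycle → C′.PeriodicCycle
    image C = record
      { lastIndex = C.len C
      ; arcs      = arcMap ∘ C.arcAt C
      ; periodic  = cong arcMap ∘ C.arcAt-% C
      ; linked    = λ i → trans (tgt-commutes _) (trans (cong vertexMap (C.closed C i)) (sym (src-commutes _)))
      ; injective = λ i<L j<L eq → C.src-arcAt-injective-< C i<L j<L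
          (vertexMap-injective (trans (sym (src-commutes _)) (trans eq (src-commutes _))))
      }

    lift : C.Cycle → C′.Cycle
    lift = C′.toCycle ∘ image

    arcAt-lift : ∀ C i → C′.arcAt (lift C) i ≡ arcMap (C.arcAt C i)
    arcAt-lift C = C′.arcAt-toCycle (image C)

    src-lift : ∀ C D i j → vertexMap (G.src (C.arcAt C i)) ≡ vertexMap (G.src (C.arcAt D j))
             → G′.src (C′.arcAt (lift C) i) ≡ G′.src (C′.arcAt (lift D) j)
    src-lift C D i j eq = trans (cong G′.src (arcAt-lift C i)) (trans (src-commutes _)
                            (trans eq (trans (sym (src-commutes _)) (cong G′.src (sym (arcAt-lift D j))))))

    src-lift⁻¹ : ∀ C D i j → G′.src (C′.arcAt (lift C) i) ≡ G′.src (C′.arcAt (lift D) j)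
               → vertexMap (G.src (C.arcAt C i)) ≡ vertexMap (G.src (C.arcAt D j))
    src-lift⁻¹ C D i j eq = trans (sym (src-commutes _)) (trans (cong G′.src (sym (arcAt-lift C i)))
                              (trans eq (trans (cong G′.src (arcAt-lift D j)) (src-commutes _))))

    module _ (D : C′.Cycle) where
      preimageArc : ℕ → Fin G.m
      preimageArc i = proj₁ (covered D i)

      preimage : ∀ i → C′.arcAt D i ≡ arcMap (preimageArc i)
      preimage i = proj₂ (covered D i)

      restriction : C.PeriodicCycle
      restriction = record
        { lastIndex = C′.len D
        ; arcs      = preimageArc
        ; periodic  = λ i → arcMap-injective
            (trans (sym (preimage (i % suc (C′.len D)))) (trans (C′.arcAt-% D i) (preimage i)))
        ; linked    = λ i → vertexMap-injective (trans (sym (tgt-commutes _)) (trans (cong G′.tgt (sym (preimage i)))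
                        (trans (C′.closed D i) (trans (cong G′.src (preimage (suc i))) (src-commutes _)))))
        ; injective = λ {i} {j} i<L j<L eq → C′.src-arcAt-injective-< D i<L j<L
            (trans (cong G′.src (preimage i)) (trans (src-commutes _) (trans (cong vertexMap eq)
              (trans (sym (src-commutes _)) (cong G′.src (sym (preimage j)))))))
        }

module _ (G : Digraph) (v : Fin (Digraph.n G)) where
  open Digraph G

  sinkSrc : Fin (3 + m) → Fin (suc n)
  sinkSrc (Fin.suc (Fin.suc (Fin.suc a))) = Fin.suc (src a)
  sinkSrc _                               = Fin.suc v

  sinkTgt : Fin (3 + m) → Fin (suc n)
  sinkTgt (Fin.suc (Fin.suc (Fin.suc a))) = Fin.suc (tgt a)
  sinkTgt _                               = Fin.zero

  addSink : Digraph
  addSink = record { n = suc n ; m = 3 + m ; src = sinkSrc ; tgt = sinkTgt }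

  private
    sinkSrc≢zero : ∀ x → sinkSrc x ≢ Fin.zero
    sinkSrc≢zero (Fin.suc (Fin.suc (Fin.suc a))) ()

    sinkTgt≢zero⇒old : ∀ x → sinkTgt x ≢ Fin.zero → ∃ λ a → x ≡ Fin.suc (Fin.suc (Fin.suc a))
    sinkTgt≢zero⇒old Fin.zero                          ≢zero = ⊥-elim (≢zero refl)
    sinkTgt≢zero⇒old (Fin.suc Fin.zero)                ≢zero = ⊥-elim (≢zero refl)
    sinkTgt≢zero⇒old (Fin.suc (Fin.suc Fin.zero))      ≢zero = ⊥-elim (≢zero refl)
    sinkTgt≢zero⇒old (Fin.suc (Fin.suc (Fin.suc a))) _     = a , refl

  addSink-correspondence : CycleCorrespondence G addSink
  addSink-correspondence = embedding-correspondence embedding λ D i →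
      sinkTgt≢zero⇒old (Cycles.arcAt addSink D i) (sinkSrc≢zero _ ∘ trans (sym (SimpleCycle.closed D i)))
    where
    embedding : Embedding G addSink
    embedding = record
      { arcMap              = λ a → Fin.suc (Fin.suc (Fin.suc a))
      ; vertexMap           = Fin.suc
      ; arcMap-injective    = Finₚ.suc-injective ∘ Finₚ.suc-injective ∘ Finₚ.suc-injective
      ; vertexMap-injective = Finₚ.suc-injective
      ; src-commutes        = λ _ → refl
      ; tgt-commutes        = λ _ → refl
      }

reverse : Digraph → Digraph
reverse G = record { n = Digraph.n G ; m = Digraph.m G ; src = Digraph.tgt G ; tgt = Digraph.src G }

module Reversal (G : Digraph) where
  private
    module C = Cycles G
    module R = Cycles (reverse G)
  open Digraph G
  open C using (len; closed)
  open ≡-Reasoning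

  -- Modulo l + 1 the index l * suc i is -(i + 1), so the arcs of C are read backwards.
  reversal : C.Cycle → R.PeriodicCycle
  reversal C = record
    { lastIndex = l
    ; arcs      = λ i → C.arcAt C (l * suc i)
    ; periodic  = λ i → C.arcAt-cong C (l * suc (i % L)) (l * suc i)
                          (%-cong-*ˡ L l (suc (i % L)) (suc i) (sym (suc-%-% L i)))
    ; linked    = λ i → sym (begin
        tgt (C.arcAt C (l * suc (suc i)))        ≡⟨ closed C (l * suc (suc i)) ⟩
        src (C.arcAt C (suc (l * suc (suc i))))  ≡⟨ cong (src ∘ C.arcAt C) (step l i) ⟩
        src (C.arcAt C (l * suc i + L))          ≡⟨ cong src (C.arcAt-periodic C (l * suc i)) ⟩
        src (C.arcAt C (l * suc i))              ∎)
    ; injective = λ {i} {j} i<L j<L eq → %-injective-< L i<L j<L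
        (%-cancel-+ˡ L 1 i j (%-cancel-*ˡ-pred l (suc i) (suc j) (C.tgt-arcAt-injective C (l * suc i) (l * suc j) eq)))
    }
    where
    l : ℕ
    l = len C
    L : ℕ
    L = suc l
    step : ∀ l i → suc (l * suc (suc i)) ≡ l * suc i + suc l
    step = solve-∀

  reverseCycle : C.Cycle → R.Cycle
  reverseCycle C = R.toCycle (reversal C)

  arcAt-reverseCycle : ∀ C i → R.arcAt (reverseCycle C) i ≡ C.arcAt C (len C * suc i)
  arcAt-reverseCycle C = R.arcAt-toCycle (reversal C)

  tgt-arcAt-reverseCycle : ∀ C i → tgt (R.arcAt (reverseCycle C) i) ≡ src (C.arcAt C (len C * i))
  tgt-arcAt-reverseCycle C i = begin
    tgt (R.arcAt (reverseCycle C) i)   ≡⟨ cong tgt (arcAt-reverseCycle C i) ⟩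
    tgt (C.arcAt C (l * suc i))        ≡⟨ closed C (l * suc i) ⟩
    src (C.arcAt C (suc (l * suc i)))  ≡⟨ cong (src ∘ C.arcAt C) (step l i) ⟩
    src (C.arcAt C (l * i + suc l))    ≡⟨ cong src (C.arcAt-periodic C (l * i)) ⟩
    src (C.arcAt C (l * i))            ∎
    where
    l : ℕ
    l = len C
    step : ∀ l i → suc (l * suc i) ≡ l * i + suc l
    step = solve-∀

  reverseCycle-≈ : ∀ C D → C C.≈ D → reverseCycle C R.≈ reverseCycle D
  reverseCycle-≈ C D (l≡ , r , C≗D) = l≡ , len C * r , λ i → begin
    R.arcAt (reverseCycle C) (i + l * r)  ≡⟨ arcAt-reverseCycle C (i + l * r) ⟩
    C.arcAt C (l * suc (i + l * r))       ≡⟨ C.arcAt-+*-cong C _ r _ (l * r) (complete l i r) ⟩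
    C.arcAt C (l * suc i + r)             ≡⟨ C≗D (l * suc i) ⟩
    C.arcAt D (l * suc i)                 ≡⟨ cong (λ k → C.arcAt D (k * suc i)) l≡ ⟩
    C.arcAt D (len D * suc i)             ≡⟨ arcAt-reverseCycle D i ⟨
    R.arcAt (reverseCycle D) i            ∎
    where
    l : ℕ
    l = len C
    complete : ∀ l i r → l * suc (i + l * r) + r * suc l ≡ l * suc i + r + l * r * suc l
    complete = solve-∀

open Reversal using (reverseCycle; arcAt-reverseCycle)

reverseCycle-involutive : ∀ G C → Cycles._≈_ G (reverseCycle (reverse G) (reverseCycle G C)) C
reverseCycle-involutive G C = ≈-pointwise (reverseCycle (reverse G) (reverseCycle G C)) C refl λ i → begin
  arcAt (reverseCycle (reverse G) (reverseCycle G C)) i    ≡⟨ arcAt-reverseCycle (reverse G) (reverseCycle G C) i ⟩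
  Cycles.arcAt (reverse G) (reverseCycle G C) (l * suc i)  ≡⟨ arcAt-reverseCycle G C (l * suc i) ⟩
  arcAt C (l * suc (l * suc i))                            ≡⟨ arcAt-+*-cong C _ i i (l * suc i) (complete l i) ⟩
  arcAt C i                                                ∎
  where
  open Cycles G
  open ≡-Reasoning
  l : ℕ
  l = len C
  complete : ∀ l i → l * suc (l * suc i) + i * suc l ≡ i + l * suc i * suc l
  complete = solve-∀

reverse-correspondence : ∀ G → CycleCorrespondence G (reverse G)
reverse-correspondence G = record
  { lift         = reverseCycle G
  ; lift-≈       = Reversal.reverseCycle-≈ G
  ; lift-≈⁻¹     = λ C D rC≈rD → ≈-trans C (rr C) D (≈-sym (rr C) C (reverseCycle-involutive G C))
      (≈-trans (rr C) (rr D) D (Reversal.reverseCycle-≈ (reverse G) (reverseCycle G C) (reverseCycle G D) rC≈rD)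
        (reverseCycle-involutive G D))
  ; lift-onto    = λ D → reverseCycle (reverse G) D , reverseCycle-involutive (reverse G) D
  ; lift-Share   = λ C D sh → let i , j , eq = share⁻¹ C D sh in
      R.share (reverseCycle G C) (reverseCycle G D) (len C * i) (len D * j)
        (trans (vertex C i) (trans eq (sym (vertex D j))))
  ; lift-Share⁻¹ = λ C D sh → let p , q , eq = R.share⁻¹ (reverseCycle G C) (reverseCycle G D) sh in
      share C D (len C * p) (len D * q)
        (trans (sym (tgt-arcAt-reverseCycle C p)) (trans eq (tgt-arcAt-reverseCycle D q)))
  }
  where
  open Cycles G
  open Reversal G using (tgt-arcAt-reverseCycle)
  open Digraph G using (src; tgt)
  module R = Cycles (reverse G)

  rr : Cycle → Cycle
  rr C = reverseCycle (reverse G) (reverseCycle G C)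

  vertex : ∀ C i → tgt (R.arcAt (reverseCycle G C) (len C * i)) ≡ src (arcAt C i)
  vertex C i = trans (tgt-arcAt-reverseCycle C (len C * i))
                     (cong src (arcAt-cong C (len C * (len C * i)) i (%-*ˡ-pred-involutive (len C) i)))

≢zero⇒suc : ∀ {k} (x : Fin (suc k)) → x ≢ Fin.zero → ∃ λ y → x ≡ Fin.suc y
≢zero⇒suc Fin.zero    x≢0 = ⊥-elim (x≢0 refl)
≢zero⇒suc (Fin.suc y) _   = y , refl

padZero : ∀ {m} → ℕ → (ℕ → Fin m) → ℕ → Fin (suc m)
padZero zero    f zero    = Fin.suc (f 0)
padZero zero    f (suc _) = Fin.zero
padZero (suc l) f zero    = Fin.suc (f 0)
padZero (suc l) f (suc j) = padZero l (f ∘ suc) j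

padZero-≤ : ∀ {m} l (f : ℕ → Fin m) {j} → j ≤ l → padZero l f j ≡ Fin.suc (f j)
padZero-≤ zero    f z≤n       = refl
padZero-≤ (suc l) f {zero} _  = refl
padZero-≤ (suc l) f (s≤s j≤l) = padZero-≤ l (f ∘ suc) j≤l

padZero-> : ∀ {m} l (f : ℕ → Fin m) {j} → l < j → padZero l f j ≡ Fin.zero
padZero-> zero    f (s≤s _)   = refl
padZero-> (suc l) f (s≤s l<j) = padZero-> l (f ∘ suc) l<j

padZero-cong : ∀ {m} l {f g : ℕ → Fin m} → (∀ j → f j ≡ g j) → ∀ j → padZero l f j ≡ padZero l g j
padZero-cong zero    f≗g zero    = cong Fin.suc (f≗g 0)
padZero-cong zero    f≗g (suc _) = refl
padZero-cong (suc l) f≗g zero    = cong Fin.suc (f≗g 0)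
padZero-cong (suc l) f≗g (suc j) = padZero-cong l (f≗g ∘ suc) j

module _ (G : Digraph) (v : Fin (Digraph.n G)) (S : Fin (Digraph.m G) → Bool) where
  open Digraph G

  splitSrc : Fin (suc m) → Fin (suc n)
  splitSrc Fin.zero    = Fin.zero
  splitSrc (Fin.suc a) = Fin.suc (src a)

  splitTgt : Fin (suc m) → Fin (suc n)
  splitTgt Fin.zero    = Fin.suc v
  splitTgt (Fin.suc a) = if S a then Fin.zero else Fin.suc (tgt a)

  splitIn : Digraph
  splitIn = record { n = suc n ; m = suc m ; src = splitSrc ; tgt = splitTgt }

module SplitIn (G : Digraph) (v : Fin (Digraph.n G)) (S : Fin (Digraph.m G) → Bool)
               (S-enters : ∀ a → S a ≡ true → Digraph.tgt G a ≡ v) where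
  open Digraph G
  open Cycles G
  module C′ = Cycles (splitIn G v S)
  open ≡-Reasoning

  src′ tgt′ : Fin (suc m) → Fin (suc n)
  src′ = splitSrc G v S
  tgt′ = splitTgt G v S

  splitTgt-kept : ∀ {a} → S a ≡ false → tgt′ (Fin.suc a) ≡ Fin.suc (tgt a)
  splitTgt-kept {a} Sa rewrite Sa = refl

  splitTgt-redirected : ∀ {a} → S a ≡ true → tgt′ (Fin.suc a) ≡ Fin.zero
  splitTgt-redirected {a} Sa rewrite Sa = refl

  Avoids : Cycle → Set
  Avoids C = ∀ i → S (arcAt C i) ≡ false

  EntersLast : Cycle → Set
  EntersLast C = S (arcAt C (len C)) ≡ true

  S-arcs-congruent : ∀ C i j → S (arcAt C i) ≡ true → S (arcAt C j) ≡ true →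
                     i % suc (len C) ≡ j % suc (len C)
  S-arcs-congruent C i j Si Sj = tgt-arcAt-injective C i j (trans (S-enters _ Si) (sym (S-enters _ Sj)))

  EntersLast-unique : ∀ C → EntersLast C → ∀ {i} → i < len C → S (arcAt C i) ≡ false
  EntersLast-unique C last {i} i<l = Boolₚ.¬-not (λ Si → <⇒≢ i<l
    (%-injective-< (suc (len C)) (m<n⇒m<1+n i<l) (n<1+n (len C)) (S-arcs-congruent C i (len C) Si last)))

  liftAvoiding : ∀ C → Avoids C → C′.PeriodicCycle
  liftAvoiding C avoids = record
    { lastIndex = len C
    ; arcs      = Fin.suc ∘ arcAt C
    ; periodic  = cong Fin.suc ∘ arcAt-% C
    ; linked    = λ i → trans (splitTgt-kept (avoids i)) (cong Fin.suc (closed C i))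
    ; injective = λ i<L j<L → src-arcAt-injective-< C i<L j<L ∘ Finₚ.suc-injective
    }

  module Entering (C : Cycle) (last : EntersLast C) where
    private
      l  = len C
      L′ : ℕ
      L′ = suc (suc l)

    detour : ℕ → Fin (suc m)
    detour = padZero l (arcAt C)

    detour-old : ∀ {j} → j ≤ l → detour j ≡ Fin.suc (arcAt C j)
    detour-old = padZero-≤ l (arcAt C)

    detour-new : detour (suc l) ≡ Fin.zero
    detour-new = padZero-> l (arcAt C) (n<1+n l)

    detour-linked : ∀ j → j < L′ → tgt′ (detour j) ≡ src′ (detour (suc j % L′))
    detour-linked j j<L′ with <-cmp j l
    ... | tri< j<l _ _ = begin
      tgt′ (detour j)                  ≡⟨ cong tgt′ (detour-old (<⇒≤ j<l)) ⟩
      tgt′ (Fin.suc (arcAt C j))       ≡⟨ splitTgt-kept (EntersLast-unique C last j<l) ⟩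
      Fin.suc (tgt (arcAt C j))        ≡⟨ cong Fin.suc (closed C j) ⟩
      Fin.suc (src (arcAt C (suc j)))  ≡⟨ cong src′ (detour-old j<l) ⟨
      src′ (detour (suc j))            ≡⟨ cong (src′ ∘ detour) (m<n⇒m%n≡m (s≤s (m<n⇒m<1+n j<l))) ⟨
      src′ (detour (suc j % L′))       ∎
    ... | tri≈ _ refl _ = begin
      tgt′ (detour l)             ≡⟨ cong tgt′ (detour-old ≤-refl) ⟩
      tgt′ (Fin.suc (arcAt C l))  ≡⟨ splitTgt-redirected last ⟩
      Fin.zero                    ≡⟨ cong src′ detour-new ⟨
      src′ (detour (suc l))       ≡⟨ cong (src′ ∘ detour) (m<n⇒m%n≡m (n<1+n (suc l))) ⟨
      src′ (detour (suc l % L′))  ∎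
    ... | tri> _ _ l<j with refl ← ≤-antisym (s≤s⁻¹ j<L′) l<j = begin
      tgt′ (detour (suc l))            ≡⟨ cong tgt′ detour-new ⟩
      Fin.suc v                        ≡⟨ cong Fin.suc (S-enters _ last) ⟨
      Fin.suc (tgt (arcAt C l))        ≡⟨ cong Fin.suc (closed C l) ⟩
      Fin.suc (src (arcAt C (suc l)))  ≡⟨ cong (Fin.suc ∘ src) (arcAt-periodic C 0) ⟩
      Fin.suc (src (arcAt C 0))        ≡⟨ cong src′ (detour-old z≤n) ⟨
      src′ (detour 0)                  ≡⟨ cong (src′ ∘ detour) (n%n≡0 L′) ⟨
      src′ (detour (L′ % L′))          ∎

    detour-injective : ∀ {i j} → i < L′ → j < L′ → src′ (detour i) ≡ src′ (detour j) → i ≡ j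
    detour-injective {i} {j} i<L′ j<L′ eq with m≤n⇒m<n∨m≡n (s≤s⁻¹ i<L′) | m≤n⇒m<n∨m≡n (s≤s⁻¹ j<L′)
    ... | inj₁ i≤l | inj₁ j≤l = src-arcAt-injective-< C i≤l j≤l (Finₚ.suc-injective (begin
      Fin.suc (src (arcAt C i))  ≡⟨ cong src′ (detour-old (s≤s⁻¹ i≤l)) ⟨
      src′ (detour i)            ≡⟨ eq ⟩
      src′ (detour j)            ≡⟨ cong src′ (detour-old (s≤s⁻¹ j≤l)) ⟩
      Fin.suc (src (arcAt C j))  ∎))
    ... | inj₁ i≤l | inj₂ refl = ⊥-elim (Finₚ.0≢1+n (trans (sym (cong src′ detour-new))
                                    (trans (sym eq) (cong src′ (detour-old (s≤s⁻¹ i≤l))))))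
    ... | inj₂ refl | inj₁ j≤l = ⊥-elim (Finₚ.0≢1+n (trans (sym (cong src′ detour-new))
                                    (trans eq (cong src′ (detour-old (s≤s⁻¹ j≤l))))))
    ... | inj₂ refl | inj₂ refl = refl

    liftEntering : C′.PeriodicCycle
    liftEntering = record
      { lastIndex = suc l
      ; arcs      = λ i → detour (i % L′)
      ; periodic  = λ i → cong detour (m%n%n≡m%n i L′)
      ; linked    = λ i → trans (detour-linked (i % L′) (m%n<n i L′))
                                (cong (src′ ∘ detour) (sym (suc-%-% L′ i)))
      ; injective = λ {i} {j} i<L′ j<L′ eq → detour-injective i<L′ j<L′
          (subst₂ (λ x y → src′ (detour x) ≡ src′ (detour y))
                  (m<n⇒m%n≡m i<L′) (m<n⇒m%n≡m j<L′) eq)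
      }

  open Entering using (detour; detour-old; detour-new; liftEntering)

  -- A simple cycle contains at most one arc of S; once that arc is rotated into the last
  -- position, the lift is the cycle followed by the new arc z → v.
  Normal : Cycle → Set
  Normal C = Avoids C ⊎ EntersLast C

  liftNormal : ∀ C → Normal C → C′.Cycle
  liftNormal C (inj₁ avoids) = C′.toCycle (liftAvoiding C avoids)
  liftNormal C (inj₂ last)   = C′.toCycle (liftEntering C last)

  arcAt-liftAvoiding : ∀ C avoids i → C′.arcAt (liftNormal C (inj₁ avoids)) i ≡ Fin.suc (arcAt C i)
  arcAt-liftAvoiding C avoids = C′.arcAt-toCycle (liftAvoiding C avoids)

  arcAt-liftEntering : ∀ C last i →
                       C′.arcAt (liftNormal C (inj₂ last)) i ≡ detour C last (i % suc (suc (len C)))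
  arcAt-liftEntering C last = C′.arcAt-toCycle (liftEntering C last)

  arcAt-liftEntering-old : ∀ C last {i} → i ≤ len C →
                           C′.arcAt (liftNormal C (inj₂ last)) i ≡ Fin.suc (arcAt C i)
  arcAt-liftEntering-old C last {i} i≤l =
    trans (arcAt-liftEntering C last i) (trans (cong (detour C last) (m<n⇒m%n≡m (s≤s (m≤n⇒m≤1+n i≤l))))
                                               (detour-old C last i≤l))

  arcAt-liftEntering-new : ∀ C last → C′.arcAt (liftNormal C (inj₂ last)) (suc (len C)) ≡ Fin.zero
  arcAt-liftEntering-new C last =
    trans (arcAt-liftEntering C last (suc (len C))) (trans (cong (detour C last) (m<n⇒m%n≡m (n<1+n (suc (len C)))))
                                               (detour-new C last))

  Avoids-resp-≈ : ∀ C D → C ≈ D → Avoids C → Avoids D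
  Avoids-resp-≈ C D (_ , r , C≗D) avoids i = trans (cong S (sym (C≗D i))) (avoids (i + r))

  avoiding-≉-entering : ∀ C D → C ≈ D → Avoids C → ¬ EntersLast D
  avoiding-≉-entering C D C≈D avoids last with trans (sym last) (Avoids-resp-≈ C D C≈D avoids (len D))
  ... | ()

  lift-avoiding-≉-entering : ∀ C D avoids last →
                             ¬ (liftNormal C (inj₁ avoids) C′.≈ liftNormal D (inj₂ last))
  lift-avoiding-≉-entering C D avoids last (_ , r , C≗D) = Finₚ.0≢1+n (begin
    Fin.zero                                                 ≡⟨ arcAt-liftEntering-new D last ⟨
    C′.arcAt (liftNormal D (inj₂ last)) (suc (len D))        ≡⟨ C≗D (suc (len D)) ⟨
    C′.arcAt (liftNormal C (inj₁ avoids)) (suc (len D) + r)  ≡⟨ arcAt-liftAvoiding C avoids (suc (len D) + r) ⟩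
    Fin.suc (arcAt C (suc (len D) + r))                      ∎)

  entering-≈-pointwise : ∀ C D → EntersLast C → EntersLast D → C ≈ D → ∀ i → arcAt C i ≡ arcAt D i
  entering-≈-pointwise C D lastC lastD C≈D@(l≡ , _) = ≈-anchored C D (suc (len C)) C≈D (begin
    src (arcAt C (suc (len C)))  ≡⟨ closed C (len C) ⟨
    tgt (arcAt C (len C))        ≡⟨ S-enters _ lastC ⟩
    v                            ≡⟨ S-enters _ lastD ⟨
    tgt (arcAt D (len D))        ≡⟨ closed D (len D) ⟩
    src (arcAt D (suc (len D)))  ≡⟨ cong (λ k → src (arcAt D (suc k))) l≡ ⟨
    src (arcAt D (suc (len C)))  ∎)

  liftEntering-pointwise : ∀ C D lastC lastD → len C ≡ len D → (∀ i → arcAt C i ≡ arcAt D i)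
                         → liftNormal C (inj₂ lastC) C′.≈ liftNormal D (inj₂ lastD)
  liftEntering-pointwise C D lastC lastD l≡ C≗D =
    C′.≈-pointwise (liftNormal C (inj₂ lastC)) (liftNormal D (inj₂ lastD)) (cong suc l≡) λ i → begin
    C′.arcAt (liftNormal C (inj₂ lastC)) i             ≡⟨ arcAt-liftEntering C lastC i ⟩
    padZero (len C) (arcAt C) (i % suc (suc (len C)))  ≡⟨ padZero-cong (len C) C≗D _ ⟩
    padZero (len C) (arcAt D) (i % suc (suc (len C)))  ≡⟨ cong (λ k → padZero k (arcAt D) (i % suc (suc k))) l≡ ⟩
    padZero (len D) (arcAt D) (i % suc (suc (len D)))  ≡⟨ arcAt-liftEntering D lastD i ⟨
    C′.arcAt (liftNormal D (inj₂ lastD)) i             ∎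

  liftEntering-≈⁻¹ : ∀ C D lastC lastD →
                     liftNormal C (inj₂ lastC) C′.≈ liftNormal D (inj₂ lastD) → C ≈ D
  liftEntering-≈⁻¹ C D lastC lastD lift≈@(l≡′ , _) = ≈-pointwise C D l≡ C≗D
    where
    l≡ : len C ≡ len D
    l≡ = suc-injective l≡′
    lifts≗ : ∀ i → C′.arcAt (liftNormal C (inj₂ lastC)) i ≡ C′.arcAt (liftNormal D (inj₂ lastD)) i
    lifts≗ = C′.≈-anchored (liftNormal C (inj₂ lastC)) (liftNormal D (inj₂ lastD)) (suc (len C)) lift≈
      (cong src′ (begin
      C′.arcAt (liftNormal C (inj₂ lastC)) (suc (len C))  ≡⟨ arcAt-liftEntering-new C lastC ⟩
      Fin.zero                                            ≡⟨ arcAt-liftEntering-new D lastD ⟨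
      C′.arcAt (liftNormal D (inj₂ lastD)) (suc (len D))  ≡⟨ cong (C′.arcAt (liftNormal D (inj₂ lastD)) ∘ suc) l≡ ⟨
      C′.arcAt (liftNormal D (inj₂ lastD)) (suc (len C))  ∎))
    prefix : ∀ {i} → i ≤ len C → arcAt C i ≡ arcAt D i
    prefix {i} i≤l = Finₚ.suc-injective (begin
      Fin.suc (arcAt C i)                     ≡⟨ arcAt-liftEntering-old C lastC i≤l ⟨
      C′.arcAt (liftNormal C (inj₂ lastC)) i  ≡⟨ lifts≗ i ⟩
      C′.arcAt (liftNormal D (inj₂ lastD)) i  ≡⟨ arcAt-liftEntering-old D lastD (subst (i ≤_) l≡ i≤l) ⟩
      Fin.suc (arcAt D i)                     ∎)
    C≗D : ∀ i → arcAt C i ≡ arcAt D i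
    C≗D i = begin
      arcAt C i                  ≡⟨ arcAt-% C i ⟨
      arcAt C (i % suc (len C))  ≡⟨ prefix (s≤s⁻¹ (m%n<n i (suc (len C)))) ⟩
      arcAt D (i % suc (len C))  ≡⟨ cong (λ k → arcAt D (i % suc k)) l≡ ⟩
      arcAt D (i % suc (len D))  ≡⟨ arcAt-% D i ⟩
      arcAt D i                  ∎

  liftNormal-≈ : ∀ C D nC nD → C ≈ D → liftNormal C nC C′.≈ liftNormal D nD
  liftNormal-≈ C D (inj₁ avoidsC) (inj₁ avoidsD) (l≡ , r , C≗D) = l≡ , r , λ i → begin
    C′.arcAt (liftNormal C (inj₁ avoidsC)) (i + r)  ≡⟨ arcAt-liftAvoiding C avoidsC (i + r) ⟩
    Fin.suc (arcAt C (i + r))                       ≡⟨ cong Fin.suc (C≗D i) ⟩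
    Fin.suc (arcAt D i)                             ≡⟨ arcAt-liftAvoiding D avoidsD i ⟨
    C′.arcAt (liftNormal D (inj₁ avoidsD)) i        ∎
  liftNormal-≈ C D (inj₁ avoidsC) (inj₂ lastD) C≈D = ⊥-elim (avoiding-≉-entering C D C≈D avoidsC lastD)
  liftNormal-≈ C D (inj₂ lastC) (inj₁ avoidsD) C≈D =
    ⊥-elim (avoiding-≉-entering D C (≈-sym C D C≈D) avoidsD lastC)
  liftNormal-≈ C D (inj₂ lastC) (inj₂ lastD) C≈D =
    liftEntering-pointwise C D lastC lastD (proj₁ C≈D) (entering-≈-pointwise C D lastC lastD C≈D)

  liftNormal-≈⁻¹ : ∀ C D nC nD → liftNormal C nC C′.≈ liftNormal D nD → C ≈ D
  liftNormal-≈⁻¹ C D (inj₁ avoidsC) (inj₁ avoidsD) (l≡ , r , lifts≗) =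
    l≡ , r , λ i → Finₚ.suc-injective (begin
    Fin.suc (arcAt C (i + r))                       ≡⟨ arcAt-liftAvoiding C avoidsC (i + r) ⟨
    C′.arcAt (liftNormal C (inj₁ avoidsC)) (i + r)  ≡⟨ lifts≗ i ⟩
    C′.arcAt (liftNormal D (inj₁ avoidsD)) i        ≡⟨ arcAt-liftAvoiding D avoidsD i ⟩
    Fin.suc (arcAt D i)                             ∎)
  liftNormal-≈⁻¹ C D (inj₁ avoidsC) (inj₂ lastD) lift≈ =
    ⊥-elim (lift-avoiding-≉-entering C D avoidsC lastD lift≈)
  liftNormal-≈⁻¹ C D (inj₂ lastC) (inj₁ avoidsD) lift≈ =
    ⊥-elim (lift-avoiding-≉-entering D C avoidsD lastC
             (C′.≈-sym (liftNormal C (inj₂ lastC)) (liftNormal D (inj₁ avoidsD)) lift≈))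
  liftNormal-≈⁻¹ C D (inj₂ lastC) (inj₂ lastD) = liftEntering-≈⁻¹ C D lastC lastD

  normalise : ∀ C → ∃ λ C₁ → C ≈ C₁ × Normal C₁
  normalise C with Finₚ.any? (λ p → S (arc C p) Boolₚ.≟ true)
  ... | yes (p , Sp) = rotate C (suc (toℕ p)) , ≈-rotate C (suc (toℕ p)) ,
                       inj₂ (trans (cong S (arcAt-rotate-last C p)) Sp)
  ... | no noS       = C , ≈-refl C , inj₁ λ i → Boolₚ.¬-not (λ Si → noS (cyc G (len C) i , Si))

  splitTgt≡suc : ∀ a {w} → tgt′ (Fin.suc a) ≡ Fin.suc w → S a ≡ false × tgt a ≡ w
  splitTgt≡suc a eq with S a
  ... | true  = ⊥-elim (Finₚ.0≢1+n eq)
  ... | false = refl , Finₚ.suc-injective eq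

  splitTgt≡zero : ∀ a → tgt′ (Fin.suc a) ≡ Fin.zero → S a ≡ true
  splitTgt≡zero a eq with S a
  ... | true  = refl
  ... | false = ⊥-elim (Finₚ.0≢1+n (sym eq))

  module AvoidingNew (D : C′.Cycle) (old : ∀ i → C′.arcAt D i ≢ Fin.zero) where
    oldArc : ℕ → Fin m
    oldArc i = proj₁ (≢zero⇒suc (C′.arcAt D i) (old i))

    arcAt≡oldArc : ∀ i → C′.arcAt D i ≡ Fin.suc (oldArc i)
    arcAt≡oldArc i = proj₂ (≢zero⇒suc (C′.arcAt D i) (old i))

    oldArc-step : ∀ i → S (oldArc i) ≡ false × tgt (oldArc i) ≡ src (oldArc (suc i))
    oldArc-step i = splitTgt≡suc (oldArc i) (begin
      tgt′ (Fin.suc (oldArc i))       ≡⟨ cong tgt′ (arcAt≡oldArc i) ⟨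
      tgt′ (C′.arcAt D i)             ≡⟨ C′.closed D i ⟩
      src′ (C′.arcAt D (suc i))       ≡⟨ cong src′ (arcAt≡oldArc (suc i)) ⟩
      Fin.suc (src (oldArc (suc i)))  ∎)

    restriction : PeriodicCycle
    restriction = record
      { lastIndex = C′.len D
      ; arcs      = oldArc
      ; periodic  = λ i → Finₚ.suc-injective (trans (sym (arcAt≡oldArc (i % suc (C′.len D))))
                                               (trans (C′.arcAt-% D i) (arcAt≡oldArc i)))
      ; linked    = proj₂ ∘ oldArc-step
      ; injective = λ {i} {j} i<L j<L eq → C′.src-arcAt-injective-< D i<L j<L
          (trans (cong src′ (arcAt≡oldArc i))
                 (trans (cong Fin.suc eq) (cong src′ (sym (arcAt≡oldArc j)))))
      }

    avoids : Avoids (toCycle restriction)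
    avoids i = trans (cong S (arcAt-toCycle restriction i)) (proj₁ (oldArc-step i))

    lift≈ : liftNormal (toCycle restriction) (inj₁ avoids) C′.≈ D
    lift≈ = C′.≈-pointwise (liftNormal (toCycle restriction) (inj₁ avoids)) D refl λ i →
      trans (arcAt-liftAvoiding (toCycle restriction) avoids i)
            (trans (cong Fin.suc (arcAt-toCycle restriction i)) (sym (arcAt≡oldArc i)))

  new-not-loop : ∀ D → C′.arcAt D (C′.len D) ≡ Fin.zero → C′.len D ≢ 0
  new-not-loop D new-last len≡0 = Finₚ.0≢1+n (sym (begin
    Fin.suc v                           ≡⟨ cong tgt′ new-last ⟨
    tgt′ (C′.arcAt D (C′.len D))        ≡⟨ C′.closed D (C′.len D) ⟩
    src′ (C′.arcAt D (suc (C′.len D)))  ≡⟨ cong src′ (C′.arcAt-periodic D 0) ⟩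
    src′ (C′.arcAt D 0)                 ≡⟨ cong (src′ ∘ C′.arcAt D) len≡0 ⟨
    src′ (C′.arcAt D (C′.len D))        ≡⟨ cong src′ new-last ⟩
    Fin.zero                            ∎))

  module EnteringNew (D : C′.Cycle) (ℓ : ℕ) (len≡ : suc ℓ ≡ C′.len D)
                     (new-last : C′.arcAt D (suc ℓ) ≡ Fin.zero) where
    private
      K : ℕ
      K = suc ℓ

    arcAtD-cong : ∀ i j → i % suc K ≡ j % suc K → C′.arcAt D i ≡ C′.arcAt D j
    arcAtD-cong i j eq = C′.arcAt-cong D i j (subst (λ k → i % suc k ≡ j % suc k) len≡ eq)

    old : ∀ {j} → j < K → C′.arcAt D j ≢ Fin.zero
    old {j} j<K eq = <⇒≢ j<K (C′.src-arcAt-injective-< D (subst (j <_) (cong suc len≡) (m<n⇒m<1+n j<K))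
      (subst (K <_) (cong suc len≡) (n<1+n K)) (cong src′ (trans eq (sym new-last))))

    oldArc : ℕ → Fin m
    oldArc i = proj₁ (≢zero⇒suc (C′.arcAt D (i % K)) (old (m%n<n i K)))

    arcAt≡oldArc : ∀ i → C′.arcAt D (i % K) ≡ Fin.suc (oldArc i)
    arcAt≡oldArc i = proj₂ (≢zero⇒suc (C′.arcAt D (i % K)) (old (m%n<n i K)))

    src-oldArc : ∀ i → src′ (C′.arcAt D (i % K)) ≡ Fin.suc (src (oldArc i))
    src-oldArc i = cong src′ (arcAt≡oldArc i)

    tgt-oldArc : ∀ i → tgt′ (Fin.suc (oldArc i)) ≡ src′ (C′.arcAt D (suc (i % K)))
    tgt-oldArc i = trans (cong tgt′ (sym (arcAt≡oldArc i))) (C′.closed D (i % K))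

    oldArc-redirected : ∀ i → i % K ≡ ℓ → S (oldArc i) ≡ true
    oldArc-redirected i i≡ℓ = splitTgt≡zero (oldArc i) (begin
      tgt′ (Fin.suc (oldArc i))        ≡⟨ tgt-oldArc i ⟩
      src′ (C′.arcAt D (suc (i % K)))  ≡⟨ cong (src′ ∘ C′.arcAt D ∘ suc) i≡ℓ ⟩
      src′ (C′.arcAt D K)              ≡⟨ cong src′ new-last ⟩
      Fin.zero                         ∎)

    oldArc-linked : ∀ i → tgt (oldArc i) ≡ src (oldArc (suc i))
    oldArc-linked i with m≤n⇒m<n∨m≡n (s≤s⁻¹ (m%n<n i K))
    ... | inj₁ j<ℓ = proj₂ (splitTgt≡suc (oldArc i) (begin
      tgt′ (Fin.suc (oldArc i))            ≡⟨ tgt-oldArc i ⟩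
      src′ (C′.arcAt D (suc (i % K)))      ≡⟨ cong (src′ ∘ C′.arcAt D) (m<n⇒m%n≡m (s≤s j<ℓ)) ⟨
      src′ (C′.arcAt D (suc (i % K) % K))  ≡⟨ cong (src′ ∘ C′.arcAt D) (suc-%-% K i) ⟨
      src′ (C′.arcAt D (suc i % K))        ≡⟨ src-oldArc (suc i) ⟩
      Fin.suc (src (oldArc (suc i)))       ∎))
    ... | inj₂ j≡ℓ = trans (S-enters _ (oldArc-redirected i j≡ℓ)) (Finₚ.suc-injective (begin
      Fin.suc v                       ≡⟨ cong tgt′ new-last ⟨
      tgt′ (C′.arcAt D K)             ≡⟨ C′.closed D K ⟩
      src′ (C′.arcAt D (suc K))       ≡⟨ cong src′ (arcAtD-cong (suc K) (suc i % K) wrap) ⟩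
      src′ (C′.arcAt D (suc i % K))   ≡⟨ src-oldArc (suc i) ⟩
      Fin.suc (src (oldArc (suc i)))  ∎))
      where
      wrap : suc K % suc K ≡ (suc i % K) % suc K
      wrap = trans (n%n≡0 (suc K))
                   (sym (cong (_% suc K) (trans (suc-%-% K i) (trans (cong (λ x → suc x % K) j≡ℓ) (n%n≡0 K)))))

    bound : ∀ i → i % K < suc (C′.len D)
    bound i = subst (i % K <_) (cong suc len≡) (m<n⇒m<1+n (m%n<n i K))

    restriction : PeriodicCycle
    restriction = record
      { lastIndex = ℓ
      ; arcs      = oldArc
      ; periodic  = λ i → Finₚ.suc-injective (trans (sym (arcAt≡oldArc (i % K)))
                            (trans (cong (C′.arcAt D) (m%n%n≡m%n i K)) (arcAt≡oldArc i)))
      ; linked    = oldArc-linked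
      ; injective = λ {i} {j} i<K j<K eq → %-injective-< K i<K j<K
          (C′.src-arcAt-injective-< D (bound i) (bound j)
            (trans (src-oldArc i) (trans (cong Fin.suc eq) (sym (src-oldArc j)))))
      }

    entersLast : EntersLast (toCycle restriction)
    entersLast = trans (cong S (arcAt-toCycle restriction ℓ)) (oldArc-redirected ℓ (m<n⇒m%n≡m (n<1+n ℓ)))

    lift≈ : liftNormal (toCycle restriction) (inj₂ entersLast) C′.≈ D
    lift≈ = C′.≈-pointwise (liftNormal (toCycle restriction) (inj₂ entersLast)) D len≡ λ i → begin
      C′.arcAt (liftNormal (toCycle restriction) (inj₂ entersLast)) i
        ≡⟨ arcAt-liftEntering (toCycle restriction) entersLast i ⟩
      detour (toCycle restriction) entersLast (i % suc K)
        ≡⟨ detour≡arcAt (m%n<n i (suc K)) ⟩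
      C′.arcAt D (i % suc K)
        ≡⟨ arcAtD-cong (i % suc K) i (m%n%n≡m%n i (suc K)) ⟩
      C′.arcAt D i ∎
      where
      detour≡arcAt : ∀ {j} → j < suc K → detour (toCycle restriction) entersLast j ≡ C′.arcAt D j
      detour≡arcAt {j} j<L with m≤n⇒m<n∨m≡n (s≤s⁻¹ j<L)
      ... | inj₁ j<K = begin
        detour (toCycle restriction) entersLast j  ≡⟨ detour-old (toCycle restriction) entersLast (s≤s⁻¹ j<K) ⟩
        Fin.suc (arcAt (toCycle restriction) j)    ≡⟨ cong Fin.suc (arcAt-toCycle restriction j) ⟩
        Fin.suc (oldArc j)                         ≡⟨ arcAt≡oldArc j ⟨
        C′.arcAt D (j % K)                         ≡⟨ cong (C′.arcAt D) (m<n⇒m%n≡m j<K) ⟩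
        C′.arcAt D j                               ∎
      ... | inj₂ refl = trans (detour-new (toCycle restriction) entersLast) (sym new-last)

  liftNormal-onto : ∀ D → ∃₂ λ C nC → liftNormal C nC C′.≈ D
  liftNormal-onto D with Finₚ.any? (λ p → C′.arc D p Finₚ.≟ Fin.zero)
  ... | no noNew = toCycle restriction , inj₁ avoids , lift≈
    where open AvoidingNew D (λ i new → noNew (cyc (splitIn G v S) (C′.len D) i , new))
  ... | yes (q , new) = toCycle restriction , inj₂ entersLast ,
                        C′.≈-trans (liftNormal (toCycle restriction) (inj₂ entersLast)) D₁ D
                                   lift≈ (C′.≈-sym D D₁ (C′.≈-rotate D (suc (toℕ q))))
    where
    D₁ : C′.Cycle
    D₁ = C′.rotate D (suc (toℕ q))
    new-last : C′.arcAt D₁ (C′.len D) ≡ Fin.zero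
    new-last = trans (C′.arcAt-rotate-last D q) new
    len≡ : suc (ℕ.pred (C′.len D)) ≡ C′.len D
    len≡ = suc-pred (C′.len D) {{ℕ.≢-nonZero (new-not-loop D₁ new-last)}}
    open EnteringNew D₁ (ℕ.pred (C′.len D)) len≡
                     (subst (λ k → C′.arcAt D₁ k ≡ Fin.zero) (sym len≡) new-last)

  liftNormal-visits : ∀ C nC j → ∃ λ p → src′ (C′.arcAt (liftNormal C nC) p) ≡ Fin.suc (src (arcAt C j))
  liftNormal-visits C (inj₁ avoids) j = j , cong src′ (arcAt-liftAvoiding C avoids j)
  liftNormal-visits C (inj₂ last) j = j % suc (len C) ,
    trans (cong src′ (arcAt-liftEntering-old C last (s≤s⁻¹ (m%n<n j (suc (len C))))))
          (cong (Fin.suc ∘ src) (arcAt-% C j))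

  liftNormal-visited : ∀ C nC p →
    (∃ λ j → src′ (C′.arcAt (liftNormal C nC) p) ≡ Fin.suc (src (arcAt C j)))
    ⊎ (src′ (C′.arcAt (liftNormal C nC) p) ≡ Fin.zero × EntersLast C)
  liftNormal-visited C (inj₁ avoids) p = inj₁ (p , cong src′ (arcAt-liftAvoiding C avoids p))
  liftNormal-visited C (inj₂ last) p with m≤n⇒m<n∨m≡n (s≤s⁻¹ (m%n<n p (suc (suc (len C)))))
  ... | inj₁ j<L  = inj₁ (p % suc (suc (len C)) , cong src′
                      (trans (arcAt-liftEntering C last p) (detour-old C last (s≤s⁻¹ j<L))))
  ... | inj₂ j≡L′ = inj₂ (cong src′
                      (trans (arcAt-liftEntering C last p)
                             (trans (cong (detour C last) j≡L′) (detour-new C last))) , last)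

  liftNormal-Share : ∀ C D nC nD → Share G C D → Share (splitIn G v S) (liftNormal C nC) (liftNormal D nD)
  liftNormal-Share C D nC nD sh with share⁻¹ C D sh
  ... | i , j , eq with liftNormal-visits C nC i | liftNormal-visits D nD j
  ... | p , visitsC | q , visitsD =
    C′.share (liftNormal C nC) (liftNormal D nD) p q (trans visitsC (trans (cong Fin.suc eq) (sym visitsD)))

  liftNormal-Share⁻¹ : ∀ C D nC nD → Share (splitIn G v S) (liftNormal C nC) (liftNormal D nD) → Share G C D
  liftNormal-Share⁻¹ C D nC nD sh with C′.share⁻¹ (liftNormal C nC) (liftNormal D nD) sh
  ... | p , q , eq with liftNormal-visited C nC p | liftNormal-visited D nD q
  ... | inj₁ (i , atC) | inj₁ (j , atD) = share C D i j (Finₚ.suc-injective (trans (sym atC) (trans eq atD)))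
  ... | inj₁ (i , atC) | inj₂ (atD , _) = ⊥-elim (Finₚ.0≢1+n (trans (sym atD) (trans (sym eq) atC)))
  ... | inj₂ (atC , _) | inj₁ (j , atD) = ⊥-elim (Finₚ.0≢1+n (trans (sym atC) (trans eq atD)))
  ... | inj₂ (_ , lastC) | inj₂ (_ , lastD) = share C D (suc (len C)) (suc (len D)) (begin
    src (arcAt C (suc (len C)))  ≡⟨ closed C (len C) ⟨
    tgt (arcAt C (len C))        ≡⟨ S-enters _ lastC ⟩
    v                            ≡⟨ S-enters _ lastD ⟨
    tgt (arcAt D (len D))        ≡⟨ closed D (len D) ⟩
    src (arcAt D (suc (len D)))  ∎)

  splitIn-correspondence : CycleCorrespondence G (splitIn G v S)
  splitIn-correspondence = record
    { lift         = lift
    ; lift-≈       = λ C D C≈D → liftNormal-≈ (N C) (N D) (normal C) (normal D)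
        (≈-trans (N C) C (N D) (≈-sym C (N C) (≈N C)) (≈-trans C D (N D) C≈D (≈N D)))
    ; lift-≈⁻¹     = λ C D lift≈ → ≈-trans C (N C) D (≈N C)
        (≈-trans (N C) (N D) D (liftNormal-≈⁻¹ (N C) (N D) (normal C) (normal D) lift≈)
                                (≈-sym D (N D) (≈N D)))
    ; lift-onto    = λ D′ → let C , nC , lift≈ = liftNormal-onto D′ in
        C , C′.≈-trans (lift C) (liftNormal C nC) D′
                       (liftNormal-≈ (N C) C (normal C) nC (≈-sym C (N C) (≈N C))) lift≈
    ; lift-Share   = λ C D sh → liftNormal-Share (N C) (N D) (normal C) (normal D)
        (Share-resp-≈ C (N C) D (N D) (≈N C) (≈N D) sh)
    ; lift-Share⁻¹ = λ C D sh → Share-resp-≈ (N C) C (N D) D (≈-sym C (N C) (≈N C)) (≈-sym D (N D) (≈N D))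
        (liftNormal-Share⁻¹ (N C) (N D) (normal C) (normal D) sh)
    }
    where
    N : Cycle → Cycle
    N C = proj₁ (normalise C)
    ≈N : ∀ C → C ≈ N C
    ≈N C = proj₁ (proj₂ (normalise C))
    normal : ∀ C → Normal (N C)
    normal C = proj₂ (proj₂ (normalise C))
    lift : Cycle → C′.Cycle
    lift C = liftNormal (N C) (normal C)

indicator : ∀ {P : Set} → Dec P → ℕ
indicator (yes _) = 1
indicator (no _)  = 0

indicator-yes : ∀ {P : Set} (p? : Dec P) → P → indicator p? ≡ 1
indicator-yes (yes _) _  = refl
indicator-yes (no ¬p) p  = ⊥-elim (¬p p)

indicator-no : ∀ {P : Set} (p? : Dec P) → ¬ P → indicator p? ≡ 0
indicator-no (yes p) ¬p = ⊥-elim (¬p p)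
indicator-no (no _)  _  = refl

indicator-cong : ∀ {P Q : Set} (p? : Dec P) (q? : Dec Q) → (P → Q) → (Q → P) → indicator p? ≡ indicator q?
indicator-cong (yes _) (yes _) _   _   = refl
indicator-cong (yes p) (no ¬q) p⇒q _   = ⊥-elim (¬q (p⇒q p))
indicator-cong (no ¬p) (yes q) _   q⇒p = ⊥-elim (¬p (q⇒p q))
indicator-cong (no _)  (no _)  _   _   = refl

indicator-suc : ∀ {n} (x y : Fin n) → indicator (Fin.suc x ≟ Fin.suc y) ≡ indicator (x ≟ y)
indicator-suc x y = indicator-cong (Fin.suc x ≟ Fin.suc y) (x ≟ y) Finₚ.suc-injective (cong Fin.suc)

length-filter-tabulate : ∀ {A : Set} {P : Pred A _} (P? : Decidable P) {m} (f : Fin m → A) →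
                         length (filter P? (tabulate f)) ≡ sum (λ a → indicator (P? (f a)))
length-filter-tabulate P? {zero}  f = refl
length-filter-tabulate P? {suc m} f with P? (f Fin.zero)
... | yes _ = cong suc (length-filter-tabulate P? (f ∘ Fin.suc))
... | no _  = length-filter-tabulate P? (f ∘ Fin.suc)

sum-zero : ∀ {n} (f : Fin n → ℕ) → (∀ a → f a ≡ 0) → sum f ≡ 0
sum-zero {zero}  f f≗0 = refl
sum-zero {suc n} f f≗0 = cong₂ _+_ (f≗0 Fin.zero) (sum-zero (f ∘ Fin.suc) (f≗0 ∘ Fin.suc))

sum-indicator-suc≟zero : ∀ {m n} (f : Fin m → Fin n) → sum (λ a → indicator (Fin.suc (f a) ≟ Fin.zero)) ≡ 0
sum-indicator-suc≟zero f = sum-zero (λ a → indicator (Fin.suc (f a) ≟ Fin.zero)) (λ _ → refl)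

sum-indicator-≡ : ∀ {m} (b : Fin m) → sum (λ a → indicator (a ≟ b)) ≡ 1
sum-indicator-≡ {suc m} Fin.zero    = cong suc (sum-indicator-suc≟zero {m} (λ a → a))
sum-indicator-≡ {suc m} (Fin.suc b) = trans (sum-cong-≗ (λ a → indicator-suc a b)) (sum-indicator-≡ b)

sum-indicator-suc : ∀ {m n} (f : Fin m → Fin n) w →
                    sum (λ a → indicator (Fin.suc (f a) ≟ Fin.suc w)) ≡ sum (λ a → indicator (f a ≟ w))
sum-indicator-suc f w = sum-cong-≗ λ a → indicator-suc (f a) w

sum-<-at : ∀ {n} (f g : Fin n → ℕ) v → (∀ w → w ≢ v → f w ≡ g w) → f v < g v → sum f < sum g
sum-<-at f g Fin.zero    f≗g fv<gv = +-mono-<-≤ fv<gv (≤-reflexive (sum-cong-≗ (λ w → f≗g (Fin.suc w) (λ ()))))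
sum-<-at f g (Fin.suc v) f≗g fv<gv = +-mono-≤-< (≤-reflexive (f≗g Fin.zero (λ ())))
  (sum-<-at (f ∘ Fin.suc) (g ∘ Fin.suc) v (λ w w≢v → f≗g (Fin.suc w) (w≢v ∘ Finₚ.suc-injective)) fv<gv)

witness : ∀ {m} {P : Pred (Fin m) _} (P? : Decidable P) → 1 ≤ sum (λ a → indicator (P? a)) → ∃ P
witness {suc m} P? 1≤ with P? Fin.zero
... | yes p = Fin.zero , p
... | no _  = let a , pa = witness (P? ∘ Fin.suc) 1≤ in Fin.suc a , pa

two-witnesses : ∀ {m} {P : Pred (Fin m) _} (P? : Decidable P) → 2 ≤ sum (λ a → indicator (P? a)) →
                ∃₂ λ a b → a ≢ b × P a × P b
two-witnesses {suc m} P? 2≤ with P? Fin.zero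
... | yes p = let b , pb = witness (P? ∘ Fin.suc) (s≤s⁻¹ 2≤) in Fin.zero , Fin.suc b , (λ ()) , p , pb
... | no _  = let a , b , a≢b , pa , pb = two-witnesses (P? ∘ Fin.suc) 2≤ in
              Fin.suc a , Fin.suc b , a≢b ∘ Finₚ.suc-injective , pa , pb

deg : (G : Digraph) → Fin (Digraph.n G) → ℕ
deg G w = indeg G w + outdeg G w

indeg-sum : ∀ G w → indeg G w ≡ sum (λ a → indicator (Digraph.tgt G a ≟ w))
indeg-sum G w = length-filter-tabulate (λ a → Digraph.tgt G a ≟ w) (λ a → a)

outdeg-sum : ∀ G w → outdeg G w ≡ sum (λ a → indicator (Digraph.src G a ≟ w))
outdeg-sum G w = length-filter-tabulate (λ a → Digraph.src G a ≟ w) (λ a → a)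

deg-reverse : ∀ G w → deg (reverse G) w ≡ deg G w
deg-reverse G w = +-comm (outdeg G w) (indeg G w)

module _ (G : Digraph) (v : Fin (Digraph.n G)) where
  open Digraph G

  deg-addSink-new : deg (addSink G v) Fin.zero ≡ 3
  deg-addSink-new = cong₂ _+_
    (trans (indeg-sum (addSink G v) Fin.zero) (cong (3 +_) (sum-indicator-suc≟zero tgt)))
    (trans (outdeg-sum (addSink G v) Fin.zero) (sum-indicator-suc≟zero src))

  deg-addSink-old : ∀ w → deg (addSink G v) (Fin.suc w) ≡ 3 * indicator (v ≟ w) + deg G w
  deg-addSink-old w = begin
    indeg (addSink G v) (Fin.suc w) + outdeg (addSink G v) (Fin.suc w)
      ≡⟨ cong₂ _+_ (trans (indeg-sum (addSink G v) (Fin.suc w)) (trans (sum-indicator-suc tgt w) (sym (indeg-sum G w))))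
                   (outdeg-sum (addSink G v) (Fin.suc w)) ⟩
    indeg G w + (i + (i + (i + sum (λ a → indicator (Fin.suc (src a) ≟ Fin.suc w)))))
      ≡⟨ cong (λ x → indeg G w + (i + (i + (i + x)))) (trans (sum-indicator-suc src w) (sym (outdeg-sum G w))) ⟩
    indeg G w + (i + (i + (i + outdeg G w)))
      ≡⟨ cong (λ j → indeg G w + (j + (j + (j + outdeg G w)))) i≡ ⟩
    indeg G w + (j + (j + (j + outdeg G w)))
      ≡⟨ rearrange (indeg G w) j (outdeg G w) ⟩
    3 * j + (indeg G w + outdeg G w)  ∎
    where
    open ≡-Reasoning
    i : ℕ
    i = indicator (Fin.suc v ≟ Fin.suc w)
    j : ℕ
    j = indicator (v ≟ w)
    i≡ : i ≡ j
    i≡ = indicator-suc v w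
    rearrange : ∀ x j y → x + (j + (j + (j + y))) ≡ 3 * j + (x + y)
    rearrange = solve-∀

module _ (G : Digraph) (v : Fin (Digraph.n G)) (S : Fin (Digraph.m G) → Bool)
         (S-enters : ∀ a → S a ≡ true → Digraph.tgt G a ≡ v) where
  open Digraph G
  open ≡-Reasoning

  ∣S∣ : ℕ
  ∣S∣ = sum (λ a → indicator (S a Boolₚ.≟ true))

  private
    G′ : Digraph
    G′ = splitIn G v S

    outdeg-splitIn-old : ∀ w → outdeg G′ (Fin.suc w) ≡ outdeg G w
    outdeg-splitIn-old w = trans (outdeg-sum G′ (Fin.suc w)) (trans (sum-indicator-suc src w) (sym (outdeg-sum G w)))

    redirected-new : ∀ a → indicator (splitTgt G v S (Fin.suc a) ≟ Fin.zero) ≡ indicator (S a Boolₚ.≟ true)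
    redirected-new a with S a
    ... | true  = refl
    ... | false = refl

    redirected-old : ∀ a w → w ≢ v → indicator (splitTgt G v S (Fin.suc a) ≟ Fin.suc w) ≡ indicator (tgt a ≟ w)
    redirected-old a w w≢v with S a in Sa
    ... | true  = sym (indicator-no (tgt a ≟ w) (λ tgt≡w → w≢v (trans (sym tgt≡w) (S-enters a Sa))))
    ... | false = indicator-suc (tgt a) w

    redirected-v : ∀ a → indicator (splitTgt G v S (Fin.suc a) ≟ Fin.suc v) + indicator (S a Boolₚ.≟ true)
                       ≡ indicator (tgt a ≟ v)
    redirected-v a with S a in Sa
    ... | true  = sym (indicator-yes (tgt a ≟ v) (S-enters a Sa))
    ... | false = trans (+-identityʳ _) (indicator-suc (tgt a) v)

  deg-splitIn-new : deg G′ Fin.zero ≡ ∣S∣ + 1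
  deg-splitIn-new = cong₂ _+_
    (trans (indeg-sum G′ Fin.zero) (sum-cong-≗ redirected-new))
    (trans (outdeg-sum G′ Fin.zero) (cong suc (sum-indicator-suc≟zero src)))

  deg-splitIn-old : ∀ w → w ≢ v → deg G′ (Fin.suc w) ≡ deg G w
  deg-splitIn-old w w≢v = cong₂ _+_ (begin
    indeg G′ (Fin.suc w)
      ≡⟨ indeg-sum G′ (Fin.suc w) ⟩
    indicator (Fin.suc v ≟ Fin.suc w) + sum (λ a → indicator (splitTgt G v S (Fin.suc a) ≟ Fin.suc w))
      ≡⟨ cong₂ _+_ (indicator-no (Fin.suc v ≟ Fin.suc w) (w≢v ∘ sym ∘ Finₚ.suc-injective))
                   (sum-cong-≗ (λ a → redirected-old a w w≢v)) ⟩
    sum (λ a → indicator (tgt a ≟ w))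
      ≡⟨ indeg-sum G w ⟨
    indeg G w ∎) (outdeg-splitIn-old w)

  deg-splitIn-v : deg G′ (Fin.suc v) + ∣S∣ ≡ 1 + deg G v
  deg-splitIn-v = begin
    indeg G′ (Fin.suc v) + outdeg G′ (Fin.suc v) + ∣S∣
      ≡⟨ cong (λ k → indeg G′ (Fin.suc v) + k + ∣S∣) (outdeg-splitIn-old v) ⟩
    indeg G′ (Fin.suc v) + outdeg G v + ∣S∣
      ≡⟨ swap (indeg G′ (Fin.suc v)) (outdeg G v) ∣S∣ ⟩
    indeg G′ (Fin.suc v) + ∣S∣ + outdeg G v
      ≡⟨ cong (_+ outdeg G v) indeg-v ⟩
    1 + indeg G v + outdeg G v ∎
    where
    swap : ∀ a b c → a + b + c ≡ a + c + b
    swap = solve-∀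
    redirectedTo-v : Fin m → ℕ
    redirectedTo-v a = indicator (splitTgt G v S (Fin.suc a) ≟ Fin.suc v)
    inS : Fin m → ℕ
    inS a = indicator (S a Boolₚ.≟ true)
    indeg-v : indeg G′ (Fin.suc v) + ∣S∣ ≡ 1 + indeg G v
    indeg-v = begin
      indeg G′ (Fin.suc v) + ∣S∣
        ≡⟨ cong (_+ ∣S∣) (indeg-sum G′ (Fin.suc v)) ⟩
      indicator (Fin.suc v ≟ Fin.suc v) + sum redirectedTo-v + ∣S∣
        ≡⟨ cong (λ k → k + sum redirectedTo-v + ∣S∣) (indicator-yes (Fin.suc v ≟ Fin.suc v) refl) ⟩
      1 + (sum redirectedTo-v + sum inS)
        ≡⟨ cong suc (∑-distrib-+ redirectedTo-v inS) ⟨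
      1 + sum (λ a → redirectedTo-v a + inS a)
        ≡⟨ cong suc (sum-cong-≗ redirected-v) ⟩
      1 + sum (λ a → indicator (tgt a ≟ v))
        ≡⟨ cong suc (indeg-sum G v) ⟨
      1 + indeg G v ∎

pair : ∀ {m} → Fin m → Fin m → Fin m → Bool
pair a b x = does (x ≟ a) ∨ does (x ≟ b)

∣pair∣ : ∀ {m} (a b : Fin m) → a ≢ b → sum (λ x → indicator (pair a b x Boolₚ.≟ true)) ≡ 2
∣pair∣ a b a≢b = trans (sum-cong-≗ split) (trans (∑-distrib-+ (λ x → indicator (x ≟ a)) (λ x → indicator (x ≟ b)))
                         (cong₂ _+_ (sum-indicator-≡ a) (sum-indicator-≡ b)))
  where
  split : ∀ x → indicator (pair a b x Boolₚ.≟ true) ≡ indicator (x ≟ a) + indicator (x ≟ b)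
  split x with x ≟ a | x ≟ b
  ... | yes refl | yes refl = ⊥-elim (a≢b refl)
  ... | yes _    | no _     = refl
  ... | no _     | yes _    = refl
  ... | no _     | no _     = refl

pair-⊆ : ∀ {m} {P : Fin m → Set} a b → P a → P b → ∀ x → pair a b x ≡ true → P x
pair-⊆ a b Pa Pb x inPair with x ≟ a | x ≟ b
... | yes refl | _        = Pa
... | no _     | yes refl = Pb

-- Adding three arcs at a vertex of degree ≤ 2 (defect-3+) and lowering a degree ≥ 4 by
-- one (defect-suc) both decrease it.
defect : ℕ → ℕ
defect 0                   = 1
defect 1                   = 2
defect 2                   = 3
defect (suc (suc (suc k))) = k

defect-3+ : ∀ d → d ≤ 2 → defect (3 + d) < defect d
defect-3+ 0 _ = s≤s z≤n
defect-3+ 1 _ = s≤s (s≤s z≤n)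
defect-3+ 2 _ = s≤s (s≤s (s≤s z≤n))
defect-3+ (suc (suc (suc _))) (s≤s (s≤s ()))

defect-suc : ∀ d → 3 ≤ d → defect d < defect (suc d)
defect-suc 0 ()
defect-suc 1 (s≤s ())
defect-suc 2 (s≤s (s≤s ()))
defect-suc (suc (suc (suc k))) _ = n<1+n k

totalDefect : Digraph → ℕ
totalDefect G = sum (defect ∘ deg G)

totalDefect-reverse : ∀ G → totalDefect (reverse G) ≡ totalDefect G
totalDefect-reverse G = sum-cong-≗ (cong defect ∘ deg-reverse G)

sum-extend-< : ∀ {n} (f : Fin n → ℕ) (f′ : Fin (suc n) → ℕ) v → f′ Fin.zero ≡ 0 →
               (∀ w → w ≢ v → f′ (Fin.suc w) ≡ f w) → f′ (Fin.suc v) < f v → sum f′ < sum f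
sum-extend-< f f′ v f′0≡0 f′≗f f′v<fv rewrite f′0≡0 = sum-<-at (f′ ∘ Fin.suc) f v f′≗f f′v<fv

infix 4 _≺_
_≺_ : Digraph → Digraph → Set
G′ ≺ G = totalDefect G′ < totalDefect G

Reduction : Digraph → Set
Reduction G = ∃[ G′ ] G′ ≺ G × (∀ {H} → PhiIso G H → PhiIso G′ H)

addSink-reduces : ∀ G v → deg G v ≤ 2 → Reduction G
addSink-reduces G v deg≤2 = addSink G v , decrease , transport (addSink-correspondence G v)
  where
  decrease : addSink G v ≺ G
  decrease = sum-extend-< (defect ∘ deg G) (defect ∘ deg (addSink G v)) v
    (cong defect (deg-addSink-new G v))
    (λ w w≢v → cong defect (trans (deg-addSink-old G v w)
                                  (cong (λ k → 3 * k + deg G w) (indicator-no (v ≟ w) (w≢v ∘ sym)))))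
    (subst (λ d → defect d < defect (deg G v))
           (sym (trans (deg-addSink-old G v v) (cong (λ k → 3 * k + deg G v) (indicator-yes (v ≟ v) refl))))
           (defect-3+ (deg G v) deg≤2))

splitInPair-reduces : ∀ G v a b → a ≢ b → Digraph.tgt G a ≡ v → Digraph.tgt G b ≡ v →
                      4 ≤ deg G v → Reduction G
splitInPair-reduces G v a b a≢b a↦v b↦v 4≤deg =
  splitIn G v S , decrease , transport (SplitIn.splitIn-correspondence G v S S-enters)
  where
  S : Fin (Digraph.m G) → Bool
  S = pair a b
  S-enters : ∀ x → S x ≡ true → Digraph.tgt G x ≡ v
  S-enters = pair-⊆ a b a↦v b↦v
  ∣S∣≡2 : ∣S∣ G v S S-enters ≡ 2
  ∣S∣≡2 = ∣pair∣ a b a≢b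
  d′ : ℕ
  d′ = deg (splitIn G v S) (Fin.suc v)
  deg-v : suc d′ ≡ deg G v
  deg-v = suc-injective (trans (+-comm 2 d′) (trans (cong (d′ +_) (sym ∣S∣≡2)) (deg-splitIn-v G v S S-enters)))
  decrease : splitIn G v S ≺ G
  decrease = sum-extend-< (defect ∘ deg G) (defect ∘ deg (splitIn G v S)) v
    (cong defect (trans (deg-splitIn-new G v S S-enters) (cong (_+ 1) ∣S∣≡2)))
    (λ w w≢v → cong defect (deg-splitIn-old G v S S-enters w w≢v))
    (subst (λ d → defect d′ < defect d) deg-v (defect-suc d′ (s≤s⁻¹ (subst (4 ≤_) (sym deg-v) 4≤deg))))

splitIn-reduces : ∀ G v → 4 ≤ deg G v → 2 ≤ indeg G v → Reduction G
splitIn-reduces G v 4≤deg 2≤indeg =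
  let a , b , a≢b , a↦v , b↦v =
        two-witnesses (λ x → Digraph.tgt G x ≟ v) (subst (2 ≤_) (indeg-sum G v) 2≤indeg)
  in  splitInPair-reduces G v a b a≢b a↦v b↦v 4≤deg

reverse-reduces : ∀ G → Reduction (reverse G) → Reduction G
reverse-reduces G (G′ , G′≺ , transfer) =
  reverse G′ , subst₂ _<_ (sym (totalDefect-reverse G′)) (totalDefect-reverse G) G′≺ ,
  transport (reverse-correspondence G′) ∘ transfer ∘ transport (reverse-correspondence G)

indeg<2⇒outdeg≥2 : ∀ i o → 4 ≤ i + o → i < 2 → 2 ≤ o
indeg<2⇒outdeg≥2 0 o 4≤o _ = ≤-trans (s≤s (s≤s z≤n)) 4≤o
indeg<2⇒outdeg≥2 1 o (s≤s 3≤o) _ = ≤-trans (s≤s (s≤s z≤n)) 3≤o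
indeg<2⇒outdeg≥2 (suc (suc _)) _ _ (s≤s (s≤s ()))

≰2∧≢3⇒≥4 : ∀ {d} → ¬ d ≤ 2 → d ≢ 3 → 4 ≤ d
≰2∧≢3⇒≥4 d≰2 d≢3 = ≤∧≢⇒< (≰⇒> d≰2) (d≢3 ∘ sym)

reduce : ∀ G v → deg G v ≢ 3 → Reduction G
reduce G v deg≢3 with deg G v ℕ.≤? 2 | 2 ℕ.≤? indeg G v
... | yes deg≤2 | _           = addSink-reduces G v deg≤2
... | no  deg≰2 | yes 2≤indeg = splitIn-reduces G v (≰2∧≢3⇒≥4 deg≰2 deg≢3) 2≤indeg
... | no  deg≰2 | no  2≰indeg = reverse-reduces G (splitIn-reduces (reverse G) v
        (subst (4 ≤_) (sym (deg-reverse G v)) deg≥4)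
        (indeg<2⇒outdeg≥2 (indeg G v) (outdeg G v) deg≥4 (≰⇒> 2≰indeg)))
  where
  deg≥4 : 4 ≤ deg G v
  deg≥4 = ≰2∧≢3⇒≥4 deg≰2 deg≢3

cubic-or-reducible : ∀ G → Cubic G ⊎ Reduction G
cubic-or-reducible G with Finₚ.any? (λ v → ¬? (deg G v ℕ.≟ 3))
... | yes (v , deg≢3) = inj₂ (reduce G v deg≢3)
... | no  none        = inj₁ λ v → decidable-stable (deg G v ℕ.≟ 3) (λ deg≢3 → none (v , deg≢3))

≺-wellFounded : WellFounded _≺_
≺-wellFounded = On.wellFounded totalDefect <-wellFounded

cubic-realization : ∀ {H} G → Acc _≺_ G → PhiIso G H → CubicRealizable H
cubic-realization G (acc smaller) P with cubic-or-reducible G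
... | inj₁ cubic                  = G , cubic , P
... | inj₂ (G′ , G′≺G , transfer) = cubic-realization G′ (smaller G′≺G) (transfer P)

corollary3 : (H : SimpleGraph) → Realizable H ⇔ CubicRealizable H
corollary3 H = mk⇔ (λ (G , P) → cubic-realization G (≺-wellFounded G) P) (λ (G , _ , P) → G , P)
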